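{- Let $C(q)$ be a formal power series with $C(0)=1$, let $c_j:=[q^j]\,\frac{1}{C(q)}$ for $j\ge 0$ and $c_j:=0$ for $j<0$, and let $(s_{n,k})_{n\ge1,\,1\le k\le n}$ be such that for every sequence $\{a_n\}_{n\ge1}$ \[ \sum_{n\ge 1}\frac{a_n q^n}{1-q^n}=\frac{1}{C(q)}\sum_{n\ge 1}\Big(\sum_{k=1}^n s_{n,k}a_k\Big)q^n . \] Let $s^{(-1)}_{n,k}$ denote the entries of the inverse of the lower-triangular matrix $(s_{i,j})_{1\le i,j\le N}$ (with $s_{i,j}=0$ for $j>i$; the entries $s^{(-1)}_{n,k}$ do not depend on $N\ge n$, and $s^{(-1)}_{n,k}=0$ for $k>n$). For a sequence $\{a_n\}_{n\ge1}$ put $b_m:=\sum_{d\mid m}a_d$ and $B_{m}:=\sum_{k=1}^{m+1}s_{m+1,k}a_k$ for $m\ge 0$. Then for all integers $n,k\ge 1$ with $1\le k\le n$ and all $m\ge 0$: \[ \text{(i)}\quad s^{(-1)}_{n,k}=\sum_{d\mid n}c_{d-k}\,\mu(n/d);\qquad \text{(ii)}\quad c_{n-k}=\sum_{d\mid n}s^{(-1)}_{d,k}; \] \[ \text{(iii)}\quad B_m=b_{m+1}+\sum_{k=1}^{m}[q^k]C(q)\cdot b_{m+1-k}. \]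
   Context: $\mu$ is the Möbius function and $[q^j]F(q)$ denotes the coefficient of $q^j$ in a formal power series $F$. The matrix $(s_{i,j})$ is lower triangular with all diagonal entries equal to $1$, hence invertible. -}

module Defs where

open import Algebra.Bundles using (CommutativeRing)
open import Data.Bool using (Bool; if_then_else_)
open import Data.Nat using (ℕ; zero; suc; _∸_; _≤ᵇ_; _≡ᵇ_; _/_)
open import Data.Nat using () renaming (_*_ to _*ℕ_)
open import Data.Nat.Divisibility using (_∣?_)
open import Data.Nat.Primality using (prime?)
open import Data.Integer using (ℤ; +_; -[1+_]) renaming (-_ to ℤ-_)
open import Data.List using (length; filter; upTo)
open import Data.List.Relation.Unary.Any using (any?)
open import Relation.Nullary.Decidable using (_×-dec_; yes; no; does)

negOnePow : ℕ → ℤ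
negOnePow zero = + 1
negOnePow (suc k) = ℤ- negOnePow k

μ : ℕ → ℤ
μ zero = + 0
μ n@(suc _) with any? (λ p → prime? p ×-dec (p *ℕ p ∣? n)) (upTo (suc n))
... | yes _ = + 0
... | no _ = negOnePow (length (filter (λ p → prime? p ×-dec (p ∣? n)) (upTo (suc n))))

module _ {c ℓ} (R : CommutativeRing c ℓ) where
  open CommutativeRing R

  Σ₁ : ℕ → (ℕ → Carrier) → Carrier
  Σ₁ zero f = 0#
  Σ₁ (suc n) f = Σ₁ n f + f (suc n)

  Σ< : ℕ → (ℕ → Carrier) → Carrier
  Σ< zero f = 0#
  Σ< (suc n) f = Σ< n f + f n

  divSumQ : ℕ → (ℕ → ℕ → Carrier) → Carrier
  divSumQ n f = Σ< n (λ e → if does (suc e ∣? n) then f (suc e) (n / suc e) else 0#)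

  divSum : ℕ → (ℕ → Carrier) → Carrier
  divSum n f = divSumQ n (λ d _ → f d)

  δ : ℕ → ℕ → Carrier
  δ i k = if i ≡ᵇ k then 1# else 0#

  natMul : ℕ → Carrier → Carrier
  natMul zero x = 0#
  natMul (suc n) x = natMul n x + x

  intMul : ℤ → Carrier → Carrier
  intMul (+ n) x = natMul n x
  intMul -[1+ n ] x = - natMul (suc n) x

  -- formal power series are coefficient sequences ℕ → Carrier; Cauchy product
  conv : (ℕ → Carrier) → (ℕ → Carrier) → ℕ → Carrier
  conv F G m = Σ< (suc m) (λ j → F j * G (m ∸ j))

  -- [q^m] Σ_{n ≥ 1} a_n q^n / (1 - q^n) = Σ_{d ∣ m} a_d  (0 for m = 0)
  lambertCoeff : (ℕ → Carrier) → ℕ → Carrier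
  lambertCoeff a m = divSum m a

  -- [q^n] Σ_{n ≥ 1} (Σ_{k=1}^n s_{n,k} a_k) q^n   (0 for n = 0)
  sSeries : (ℕ → ℕ → Carrier) → (ℕ → Carrier) → ℕ → Carrier
  sSeries s a n = Σ₁ n (λ k → s n k * a k)

  sTri : (ℕ → ℕ → Carrier) → ℕ → ℕ → Carrier
  sTri s i j = if j ≤ᵇ i then s i j else 0#

  -- c_{d-k} with the convention c_j = 0 for j < 0
  cShift : (ℕ → Carrier) → ℕ → ℕ → Carrier
  cShift cc d k = if k ≤ᵇ d then cc (d ∸ k) else 0#

  bSeq : (ℕ → Carrier) → ℕ → Carrier
  bSeq a m = divSum m a

  BSeq : (ℕ → ℕ → Carrier) → (ℕ → Carrier) → ℕ → Carrier
  BSeq s a m = Σ₁ (suc m) (λ k → s (suc m) k * a k)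

-- Coefficientwise, the hypothesis says that the divisor sums b = (Σ_{d ∣ m} a_d)_m equal
-- C⁻¹ ⋆ X, where X_n = Σ_k s_{n,k} a_k and ⋆ is the Cauchy product. Multiplying by C gives (iii).
-- Taking for a the k-th column of s⁻¹ turns X into the unit vector at k, so the divisor sums of
-- that column are the shifted coefficients c_{n-k}: this is (ii). Möbius inversion of (ii) gives
-- (i); it rests on Σ_{d ∣ m} μ(d) = [m = 1], proved by splitting the divisors of m = m′p (p prime)
-- according to whether p divides them, using μ(pu) = −μ(u) for p ∤ u.

module Submission where

open import Defs
open import Algebra.Bundles using (CommutativeRing)
open import Data.Nat using (ℕ; suc; _∸_; _≤_)
open import Data.Product using (_×_)
open import Data.Bool using (if_then_else_)
open import Data.Empty using (⊥)
open import Data.Integer using (+_; -[1+_]) renaming (-_ to ℤ-_)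
open import Data.Nat as ℕ using (zero; _<_; z≤n; s≤s; _/_; _≟_; _≤?_; NonZero)
import Data.Nat.DivMod as ℕ
open import Data.Nat.Divisibility
import Data.Nat.Properties as ℕₚ
open import Data.Nat.Primality using (prime⇒nonZero)
open import Data.Product using (_,_; proj₁)
open import Data.Sum using (inj₁; inj₂)
open import Function using (_∘_)
open import Relation.Nullary using (¬_; Dec; yes; no; does; contradiction)
open import Relation.Nullary.Decidable using (¬?)
open import Relation.Binary.PropositionalEquality as ≡ using (_≡_; _≢_)

module Arithmetic where

  open import Data.Nat using (_+_; _*_; NonTrivial)
  open import Data.Nat.Properties
  open import Data.Nat.Coprimality using (Coprime; coprime-divisor)
  open import Data.Nat.Primality
  open import Data.Nat.Primality.Factorisation using (factorise)
  open import Data.List using (_∷_; [_]; _++_; length; filter; upTo)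
  open import Data.List.Properties using (upTo-∷ʳ; filter-++; filter-accept; filter-reject; length-++)
  open import Data.List.Relation.Unary.Any using (any?)
  open import Data.List.Relation.Unary.Any.Properties using (applyUpTo⁺; applyUpTo⁻)
  open import Data.List.Relation.Unary.All using (_∷_)
  open import Data.Product using (∃-syntax; _×_; _,_; proj₂)
  open import Data.Sum using (_⊎_; [_,_]′)
  open import Function using (id; _⇔_; Equivalence; mk⇔)
  open import Relation.Nullary.Decidable using (_×-dec_)
  open import Relation.Unary using (Pred; Decidable)
  open import Relation.Binary.PropositionalEquality hiding ([_])

  open Equivalence using (to; from)

  module _ {p} {P : Pred ℕ p} (P? : Decidable P) where

    count : ℕ → ℕ
    count n = length (filter P? (upTo n))

    count-suc : ∀ n → count (suc n) ≡ count n + length (filter P? [ n ])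
    count-suc n = begin
      length (filter P? (upTo (suc n)))              ≡⟨ cong (length ∘ filter P?) (upTo-∷ʳ n) ⟨
      length (filter P? (upTo n ++ [ n ]))           ≡⟨ cong length (filter-++ P? (upTo n) [ n ]) ⟩
      length (filter P? (upTo n) ++ filter P? [ n ]) ≡⟨ length-++ (filter P? (upTo n)) ⟩
      count n + length (filter P? [ n ])             ∎
      where open ≡-Reasoning

    count-accept : ∀ {n} → P n → count (suc n) ≡ suc (count n)
    count-accept {n} Pn = trans (count-suc n)
      (trans (cong (λ xs → count n + length xs) (filter-accept P? Pn)) (+-comm (count n) 1))

    count-reject : ∀ {n} → ¬ P n → count (suc n) ≡ count n
    count-reject {n} ¬Pn = trans (count-suc n)
      (trans (cong (λ xs → count n + length xs) (filter-reject P? ¬Pn)) (+-identityʳ (count n)))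

    count-beyond : ∀ {m} n → (∀ {r} → m ≤ r → ¬ P r) → m ≤ n → count n ≡ count m
    count-beyond zero    _  z≤n = refl
    count-beyond (suc n) ¬P m≤1+n with m≤n⇒m<n∨m≡n m≤1+n
    ... | inj₁ (s≤s m≤n) = trans (count-reject (¬P m≤n)) (count-beyond n ¬P m≤n)
    ... | inj₂ refl      = refl

  module _ {p q} {P : Pred ℕ p} {Q : Pred ℕ q} (P? : Decidable P) (Q? : Decidable Q) where

    count-cong : ∀ n → (∀ {r} → r < n → P r ⇔ Q r) → count P? n ≡ count Q? n
    count-cong zero    _   = refl
    count-cong (suc n) P⇔Q with P? n
    ... | yes Pn = trans (count-accept P? Pn) (trans (cong suc (count-cong n (P⇔Q ∘ m<n⇒m<1+n)))
                     (sym (count-accept Q? (to (P⇔Q ≤-refl) Pn))))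
    ... | no ¬Pn = trans (count-reject P? ¬Pn) (trans (count-cong n (P⇔Q ∘ m<n⇒m<1+n))
                     (sym (count-reject Q? (¬Pn ∘ from (P⇔Q ≤-refl)))))

    count-insert : ∀ {x} n → P x → ¬ Q x → (∀ {r} → r ≢ x → P r ⇔ Q r) → x < n →
                   count P? n ≡ suc (count Q? n)
    count-insert (suc n) Px ¬Qx P⇔Q x<1+n with m≤n⇒m<n∨m≡n (≤-pred x<1+n)
    ... | inj₂ refl = trans (count-accept P? Px) (cong suc (trans (count-cong n (P⇔Q ∘ <⇒≢))
                        (sym (count-reject Q? ¬Qx))))
    ... | inj₁ x<n with Q? n
    ...   | yes Qn = trans (count-accept P? (from (P⇔Q (>⇒≢ x<n)) Qn))
                       (cong suc (trans (count-insert n Px ¬Qx P⇔Q x<n) (sym (count-accept Q? Qn))))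
    ...   | no ¬Qn = trans (count-reject P? (¬Qn ∘ to (P⇔Q (>⇒≢ x<n))))
                       (trans (count-insert n Px ¬Qx P⇔Q x<n) (cong suc (sym (count-reject Q? ¬Qn))))

  prime⇒≡ : ∀ {p r} → Prime p → Prime r → r ∣ p → r ≡ p
  prime⇒≡ pp pr r∣p with prime⇒irreducible pp r∣p
  ... | inj₁ refl = contradiction pr ¬prime[1]
  ... | inj₂ r≡p  = r≡p

  ∃-prime-divisor : ∀ n → .{{NonTrivial n}} → ∃[ p ] Prime p × p ∣ n
  ∃-prime-divisor n@(suc (suc _)) with factorise n
  ... | record { factors = p ∷ _ ; isFactorisation = n≡p*ps ; factorsPrime = pp ∷ _ } =
        p , pp , subst (p ∣_) (sym n≡p*ps) (m∣m*n _)

  ∤⇒coprime : ∀ {p d} → Prime p → ¬ p ∣ d → Coprime d p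
  ∤⇒coprime pp p∤d (i∣d , i∣p) with prime⇒irreducible pp i∣p
  ... | inj₁ i≡1 = i≡1
  ... | inj₂ refl = contradiction i∣d p∤d

  ∣p*m⇒∣m : ∀ {p d m} → Prime p → ¬ p ∣ d → d ∣ p * m → d ∣ m
  ∣p*m⇒∣m pp p∤d = coprime-divisor (∤⇒coprime pp p∤d)

  ∣m*p⇒∣m : ∀ {p d m} → Prime p → ¬ p ∣ d → d ∣ m * p → d ∣ m
  ∣m*p⇒∣m {p} {d} {m} pp p∤d d∣mp = ∣p*m⇒∣m pp p∤d (subst (d ∣_) (*-comm m p) d∣mp)

  m*n∣o*m⇒n∣o : ∀ m {n o} → .{{NonZero m}} → m * n ∣ o * m → n ∣ o
  m*n∣o*m⇒n∣o m {n} {o} mn∣om = *-cancelˡ-∣ m (subst (m * n ∣_) (*-comm o m) mn∣om)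

  n∣o⇒m*n∣o*m : ∀ m {n o} → n ∣ o → m * n ∣ o * m
  n∣o⇒m*n∣o*m m {n} {o} n∣o = subst (m * n ∣_) (*-comm m o) (*-monoʳ-∣ m n∣o)

  rr∣pq⇒rr∣q : ∀ {p q r} → Prime p → ¬ p ∣ q → Prime r → r * r ∣ p * q → r * r ∣ q
  rr∣pq⇒rr∣q {p} {q} {r} pp p∤q pr rr∣pq = ∣p*m⇒∣m pp p∤rr rr∣pq
    where
    p∤rr : ¬ p ∣ r * r
    p∤rr p∣rr with refl ← prime⇒≡ pr pp ([ id , id ]′ (euclidsLemma r r pp p∣rr)) =
      p∤q (*-cancelˡ-∣ p {{prime⇒nonZero pp}} rr∣pq)

  ω? : ∀ n → Decidable (λ p → Prime p × p ∣ n)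
  ω? n p = prime? p ×-dec (p ∣? n)

  -- the number of prime divisors of n, counted exactly as in the definition of μ
  ω : ℕ → ℕ
  ω n = count (ω? n) (suc n)

  ω-prime-* : ∀ {p q} → Prime p → ¬ p ∣ q → .{{NonZero q}} → ω (p * q) ≡ suc (ω q)
  ω-prime-* {p} {q} pp p∤q = begin
    count (ω? (p * q)) (suc (p * q)) ≡⟨ count-insert (ω? (p * q)) (ω? q) (suc (p * q))
                                          (pp , m∣m*n q) (p∤q ∘ proj₂) agree (s≤s (m≤m*n p q)) ⟩
    suc (count (ω? q) (suc (p * q))) ≡⟨ cong suc (count-beyond (ω? q) (suc (p * q))
                                          (λ q<r → >⇒∤ q<r ∘ proj₂) (s≤s (m≤n*m q p))) ⟩
    suc (ω q)                        ∎
    where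
    open ≡-Reasoning
    instance _ = prime⇒nonZero pp
    agree : ∀ {r} → r ≢ p → (Prime r × r ∣ p * q) ⇔ (Prime r × r ∣ q)
    agree r≢p = mk⇔
      (λ (pr , r∣pq) → pr , [ (λ r∣p → contradiction (prime⇒≡ pp pr r∣p) r≢p) , id ]′
                               (euclidsLemma p q pr r∣pq))
      (λ (pr , r∣q) → pr , ∣n⇒∣m*n p r∣q)

  SquareFree : ℕ → Set
  SquareFree n = ∀ {r} → Prime r → ¬ r * r ∣ n

  rr∣1+n⇒r<2+n : ∀ {n r} → Prime r → r * r ∣ suc n → r < suc (suc n)
  rr∣1+n⇒r<2+n {r = r} pr rr∣n = s≤s (≤-trans (m≤m*n r r {{prime⇒nonZero pr}}) (∣⇒≤ rr∣n))

  squarefree? : ∀ n → .{{NonZero n}} → (∃[ r ] Prime r × r * r ∣ n) ⊎ SquareFree n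
  squarefree? (suc n) with any? (λ r → prime? r ×-dec (r * r ∣? suc n)) (upTo (suc (suc n)))
  ... | yes some = let r , _ , hr = applyUpTo⁻ id some in inj₁ (r , hr)
  ... | no none  = inj₂ (λ pr rr∣n → none (applyUpTo⁺ id (pr , rr∣n) (rr∣1+n⇒r<2+n pr rr∣n)))

  μ-square : ∀ {n r} → Prime r → r * r ∣ n → μ n ≡ + 0
  μ-square {zero}  _  _    = refl
  μ-square {suc n} pr rr∣n with any? (λ p → prime? p ×-dec (p * p ∣? suc n)) (upTo (suc (suc n)))
  ... | yes _   = refl
  ... | no none = contradiction (applyUpTo⁺ id (pr , rr∣n) (rr∣1+n⇒r<2+n pr rr∣n)) none

  μ-squarefree : ∀ {n} → .{{NonZero n}} → SquareFree n → μ n ≡ negOnePow (ω n)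
  μ-squarefree {suc n} sf with any? (λ p → prime? p ×-dec (p * p ∣? suc n)) (upTo (suc (suc n)))
  ... | no _     = refl
  ... | yes some = let _ , _ , pr , rr∣n = applyUpTo⁻ id some in contradiction rr∣n (sf pr)

  μ-prime-* : ∀ {p q} → Prime p → ¬ p ∣ q → .{{NonZero q}} → μ (p * q) ≡ ℤ- μ q
  μ-prime-* {p} {q} pp p∤q with squarefree? q
  ... | inj₁ (r , pr , rr∣q) =
        trans (μ-square pr (∣-trans rr∣q (n∣m*n p))) (cong ℤ-_ (sym (μ-square pr rr∣q)))
  ... | inj₂ sf = begin
    μ (p * q)             ≡⟨ μ-squarefree {{m*n≢0 p q}} (λ pr → sf pr ∘ rr∣pq⇒rr∣q pp p∤q pr) ⟩
    negOnePow (ω (p * q)) ≡⟨ cong negOnePow (ω-prime-* pp p∤q) ⟩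
    ℤ- negOnePow (ω q)    ≡⟨ cong ℤ-_ (sym (μ-squarefree sf)) ⟩
    ℤ- μ q                ∎
    where
    open ≡-Reasoning
    instance _ = prime⇒nonZero pp

  μ-prime-*-∣ : ∀ {p q} → Prime p → p ∣ q → μ (p * q) ≡ + 0
  μ-prime-*-∣ {p} pp p∣q = μ-square pp (*-monoʳ-∣ p p∣q)

open Arithmetic using (∃-prime-divisor; ∣m*p⇒∣m; m*n∣o*m⇒n∣o; n∣o⇒m*n∣o*m; μ-prime-*; μ-prime-*-∣)

module _ {c ℓ} (R : CommutativeRing c ℓ) where
  open CommutativeRing R
  open import Algebra.Properties.Ring ring using (-0#≈0#; -‿+-comm; -‿distribˡ-*; -‿involutive)
  open import Algebra.Properties.CommutativeSemigroup +-commutativeSemigroup using ()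
    renaming (interchange to +-interchange)
  open import Relation.Binary.Reasoning.Setoid setoid

  ∑ : ℕ → (ℕ → Carrier) → Carrier
  ∑ = Σ< R

  ∑-cong : ∀ n {f g} → (∀ i → i < n → f i ≈ g i) → ∑ n f ≈ ∑ n g
  ∑-cong zero    f≈g = refl
  ∑-cong (suc n) f≈g = +-cong (∑-cong n (λ i → f≈g i ∘ ℕₚ.m<n⇒m<1+n)) (f≈g n ℕₚ.≤-refl)

  ∑-cong′ : ∀ n {f g} → (∀ i → f i ≈ g i) → ∑ n f ≈ ∑ n g
  ∑-cong′ n f≈g = ∑-cong n (λ i _ → f≈g i)

  ∑-zero : ∀ n {f} → (∀ i → i < n → f i ≈ 0#) → ∑ n f ≈ 0#
  ∑-zero zero    f≈0 = refl
  ∑-zero (suc n) f≈0 = trans (+-cong (∑-zero n (λ i → f≈0 i ∘ ℕₚ.m<n⇒m<1+n)) (f≈0 n ℕₚ.≤-refl))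
                             (+-identityˡ 0#)

  ∑-distrib-+ : ∀ n f g → ∑ n (λ i → f i + g i) ≈ ∑ n f + ∑ n g
  ∑-distrib-+ zero    f g = sym (+-identityˡ 0#)
  ∑-distrib-+ (suc n) f g = trans (+-congʳ (∑-distrib-+ n f g)) (+-interchange _ _ _ _)

  *-distribˡ-∑ : ∀ n x f → x * ∑ n f ≈ ∑ n (λ i → x * f i)
  *-distribˡ-∑ zero    x f = zeroʳ x
  *-distribˡ-∑ (suc n) x f = trans (distribˡ x _ _) (+-congʳ (*-distribˡ-∑ n x f))

  *-distribʳ-∑ : ∀ n x f → ∑ n f * x ≈ ∑ n (λ i → f i * x)
  *-distribʳ-∑ n x f = trans (*-comm _ x) (trans (*-distribˡ-∑ n x f) (∑-cong′ n (λ i → *-comm x (f i))))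

  ∑-neg : ∀ n f → ∑ n (λ i → - f i) ≈ - ∑ n f
  ∑-neg zero    f = sym -0#≈0#
  ∑-neg (suc n) f = trans (+-congʳ (∑-neg n f)) (-‿+-comm _ _)

  ∑-head : ∀ n f → ∑ (suc n) f ≈ f 0 + ∑ n (f ∘ suc)
  ∑-head zero    f = trans (+-identityˡ _) (sym (+-identityʳ _))
  ∑-head (suc n) f = trans (+-congʳ (∑-head n f)) (+-assoc _ _ _)

  ∑-split : ∀ m n f → ∑ (m ℕ.+ n) f ≈ ∑ m f + ∑ n (λ i → f (m ℕ.+ i))
  ∑-split m zero    f rewrite ℕₚ.+-identityʳ m = sym (+-identityʳ _)
  ∑-split m (suc n) f rewrite ℕₚ.+-suc m n = trans (+-congʳ (∑-split m n f)) (+-assoc _ _ _)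

  ∑-extend : ∀ {m n} f → m ≤ n → (∀ i → m ≤ i → i < n → f i ≈ 0#) → ∑ n f ≈ ∑ m f
  ∑-extend {m} {n} f m≤n f≈0 = begin
    ∑ n f                                   ≡⟨ ≡.cong (λ k → ∑ k f) (ℕₚ.m+[n∸m]≡n m≤n) ⟨
    ∑ (m ℕ.+ (n ∸ m)) f                     ≈⟨ ∑-split m (n ∸ m) f ⟩
    ∑ m f + ∑ (n ∸ m) (λ i → f (m ℕ.+ i))   ≈⟨ +-congˡ (∑-zero (n ∸ m) tail≈0) ⟩
    ∑ m f + 0#                              ≈⟨ +-identityʳ _ ⟩
    ∑ m f                                   ∎
    where
    tail≈0 : ∀ i → i < n ∸ m → f (m ℕ.+ i) ≈ 0#
    tail≈0 i i<n∸m = f≈0 (m ℕ.+ i) (ℕₚ.m≤m+n m i)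
      (≡.subst (m ℕ.+ i <_) (ℕₚ.m+[n∸m]≡n m≤n) (ℕₚ.+-monoʳ-< m i<n∸m))

  ∑-single : ∀ n {f} a → a < n → (∀ i → i < n → i ≢ a → f i ≈ 0#) → ∑ n f ≈ f a
  ∑-single (suc n) a a<1+n f≈0 with ℕₚ.m≤n⇒m<n∨m≡n (ℕₚ.≤-pred a<1+n)
  ... | inj₁ a<n  = trans (+-cong (∑-single n a a<n (λ i → f≈0 i ∘ ℕₚ.m<n⇒m<1+n))
                                  (f≈0 n ℕₚ.≤-refl (ℕₚ.>⇒≢ a<n)))
                          (+-identityʳ _)
  ... | inj₂ ≡.refl = trans (+-congʳ (∑-zero n (λ i i<n → f≈0 i (ℕₚ.m<n⇒m<1+n i<n) (ℕₚ.<⇒≢ i<n))))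
                            (+-identityˡ _)

  ∑-swap : ∀ m n (f : ℕ → ℕ → Carrier) → ∑ m (λ i → ∑ n (f i)) ≈ ∑ n (λ j → ∑ m (λ i → f i j))
  ∑-swap zero    n f = sym (∑-zero n (λ _ _ → refl))
  ∑-swap (suc m) n f = trans (+-congʳ (∑-swap m n f)) (sym (∑-distrib-+ n _ _))

  Σ₁≡∑ : ∀ n f → Σ₁ R n f ≡ ∑ n (f ∘ suc)
  Σ₁≡∑ zero    f = ≡.refl
  Σ₁≡∑ (suc n) f = ≡.cong (_+ f (suc n)) (Σ₁≡∑ n f)

  -- δ, cShift and sTri unfold definitionally to when on _≟_ and _≤?_.
  when : {P : Set} → Dec P → Carrier → Carrier
  when P? x = if does P? then x else 0#

  when-yes : ∀ {P : Set} (P? : Dec P) x → P → when P? x ≈ x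
  when-yes (yes _) x _ = refl
  when-yes (no ¬p) x p = contradiction p ¬p

  when-no : ∀ {P : Set} (P? : Dec P) x → ¬ P → when P? x ≈ 0#
  when-no (yes p) x ¬p = contradiction p ¬p
  when-no (no _)  x _  = refl

  when-cong : ∀ {P : Set} (P? : Dec P) {x y} → x ≈ y → when P? x ≈ when P? y
  when-cong (yes _) x≈y = x≈y
  when-cong (no _)  x≈y = refl

  when-zero : ∀ {P : Set} (P? : Dec P) → when P? 0# ≈ 0#
  when-zero (yes _) = refl
  when-zero (no _)  = refl

  when-neg : ∀ {P : Set} (P? : Dec P) x → when P? (- x) ≈ - when P? x
  when-neg (yes _) x = refl
  when-neg (no _)  x = sym -0#≈0#

  *-when : ∀ {P : Set} (P? : Dec P) x y → x * when P? y ≈ when P? x * y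
  *-when (yes _) x y = refl
  *-when (no _)  x y = trans (zeroʳ x) (sym (zeroˡ y))

  when-⇔ : ∀ {P Q : Set} (P? : Dec P) (Q? : Dec Q) x → (P → Q) → (Q → P) → when P? x ≈ when Q? x
  when-⇔ (yes _) (yes _) x _   _   = refl
  when-⇔ (yes p) (no ¬q) x P→Q _   = contradiction (P→Q p) ¬q
  when-⇔ (no ¬p) (yes q) x _   Q→P = contradiction (Q→P q) ¬p
  when-⇔ (no _)  (no _)  x _   _   = refl

  δ-≡ : ∀ {i k} → i ≡ k → δ R i k ≈ 1#
  δ-≡ {i} {k} = when-yes (i ≟ k) 1#

  δ-≢ : ∀ {i k} → i ≢ k → δ R i k ≈ 0#
  δ-≢ {i} {k} = when-no (i ≟ k) 1#

  μᴿ : ℕ → Carrier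
  μᴿ d = intMul R (μ d) 1#

  natMul≈* : ∀ n x → natMul R n x ≈ natMul R n 1# * x
  natMul≈* zero    x = sym (zeroˡ x)
  natMul≈* (suc n) x = trans (+-cong (natMul≈* n x) (sym (*-identityˡ x))) (sym (distribʳ x _ _))

  intMul≈* : ∀ z x → intMul R z x ≈ intMul R z 1# * x
  intMul≈* (+ n)    x = natMul≈* n x
  intMul≈* -[1+ n ] x = trans (-‿cong (natMul≈* (suc n) x)) (-‿distribˡ-* _ _)

  intMul-neg : ∀ z → intMul R (ℤ- z) 1# ≈ - intMul R z 1#
  intMul-neg (+ zero)  = sym -0#≈0#
  intMul-neg (+ suc n) = refl
  intMul-neg -[1+ n ]  = sym (-‿involutive _)

  infixl 7 _⋆_
  _⋆_ : (ℕ → Carrier) → (ℕ → Carrier) → ℕ → Carrier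
  _⋆_ = conv R

  ⋆-congˡ : ∀ {F F′} → (∀ i → F i ≈ F′ i) → ∀ G m → (F ⋆ G) m ≈ (F′ ⋆ G) m
  ⋆-congˡ F≈F′ G m = ∑-cong′ (suc m) (λ j → *-congʳ (F≈F′ j))

  ⋆-congʳ : ∀ F {G G′} → (∀ i → G i ≈ G′ i) → ∀ m → (F ⋆ G) m ≈ (F ⋆ G′) m
  ⋆-congʳ F G≈G′ m = ∑-cong′ (suc m) (λ j → *-congˡ (G≈G′ (m ∸ j)))

  ⋆-suc : ∀ F G m → (F ⋆ G) (suc m) ≈ F 0 * G (suc m) + (F ∘ suc ⋆ G) m
  ⋆-suc F G m = ∑-head (suc m) (λ j → F j * G (suc m ∸ j))

  ⋆-linearˡ : ∀ x F H G m → ((λ i → x * F i + H i) ⋆ G) m ≈ x * (F ⋆ G) m + (H ⋆ G) m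
  ⋆-linearˡ x F H G m = begin
    ((λ i → x * F i + H i) ⋆ G) m
      ≈⟨ ∑-cong′ (suc m) (λ j → trans (distribʳ _ _ _) (+-congʳ (*-assoc _ _ _))) ⟩
    ∑ (suc m) (λ j → x * (F j * G (m ∸ j)) + H j * G (m ∸ j))
      ≈⟨ ∑-distrib-+ (suc m) _ _ ⟩
    ∑ (suc m) (λ j → x * (F j * G (m ∸ j))) + (H ⋆ G) m
      ≈⟨ +-congʳ (*-distribˡ-∑ (suc m) x _) ⟨
    x * (F ⋆ G) m + (H ⋆ G) m
      ∎

  ⋆-zeroˡ : ∀ {F} G m → (∀ i → F i ≈ 0#) → (F ⋆ G) m ≈ 0#
  ⋆-zeroˡ G m F≈0 = ∑-zero (suc m) (λ j _ → trans (*-congʳ (F≈0 j)) (zeroˡ _))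

  ⋆-assoc : ∀ F G H m → (F ⋆ (G ⋆ H)) m ≈ ((F ⋆ G) ⋆ H) m
  ⋆-assoc F G H zero = begin
    0# + F 0 * (0# + G 0 * H 0) ≈⟨ +-congˡ (*-congˡ (+-identityˡ _)) ⟩
    0# + F 0 * (G 0 * H 0)      ≈⟨ +-congˡ (*-assoc _ _ _) ⟨
    0# + F 0 * G 0 * H 0        ≈⟨ +-congˡ (*-congʳ (+-identityˡ _)) ⟨
    0# + (0# + F 0 * G 0) * H 0 ∎
  ⋆-assoc F G H (suc m) = begin
    (F ⋆ (G ⋆ H)) (suc m)
      ≈⟨ ⋆-suc F (G ⋆ H) m ⟩
    F 0 * (G ⋆ H) (suc m) + (F ∘ suc ⋆ (G ⋆ H)) m
      ≈⟨ +-cong (*-congˡ (⋆-suc G H m)) (⋆-assoc (F ∘ suc) G H m) ⟩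
    F 0 * (G 0 * H (suc m) + (G ∘ suc ⋆ H) m) + ((F ∘ suc ⋆ G) ⋆ H) m
      ≈⟨ trans (+-congʳ (distribˡ _ _ _)) (+-assoc _ _ _) ⟩
    F 0 * (G 0 * H (suc m)) + (F 0 * (G ∘ suc ⋆ H) m + ((F ∘ suc ⋆ G) ⋆ H) m)
      ≈⟨ +-cong (*-assoc _ _ _) (⋆-linearˡ (F 0) (G ∘ suc) (F ∘ suc ⋆ G) H m) ⟨
    F 0 * G 0 * H (suc m) + ((λ i → F 0 * G (suc i) + (F ∘ suc ⋆ G) i) ⋆ H) m
      ≈⟨ +-cong (*-congʳ (+-identityˡ _)) (⋆-congˡ (⋆-suc F G) H m) ⟨
    (F ⋆ G) 0 * H (suc m) + ((F ⋆ G) ∘ suc ⋆ H) m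
      ≈⟨ ⋆-suc (F ⋆ G) H m ⟨
    ((F ⋆ G) ⋆ H) (suc m)
      ∎

  ⋆-identityˡ : ∀ X m → ((λ i → δ R i 0) ⋆ X) m ≈ X m
  ⋆-identityˡ X zero    = trans (+-identityˡ _) (*-identityˡ _)
  ⋆-identityˡ X (suc m) = begin
    ((λ i → δ R i 0) ⋆ X) (suc m)                   ≈⟨ ⋆-suc (λ i → δ R i 0) X m ⟩
    1# * X (suc m) + ((λ i → δ R (suc i) 0) ⋆ X) m  ≈⟨ +-cong (*-identityˡ _) (⋆-zeroˡ X m (λ _ → refl)) ⟩
    X (suc m) + 0#                                  ≈⟨ +-identityʳ _ ⟩
    X (suc m)                                       ∎

  ⋆-inverseˡ : ∀ {C D} → (∀ m → (C ⋆ D) m ≈ δ R m 0) → ∀ X m → (C ⋆ (D ⋆ X)) m ≈ X m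
  ⋆-inverseˡ {C} {D} C⋆D≈1 X m = begin
    (C ⋆ (D ⋆ X)) m         ≈⟨ ⋆-assoc C D X m ⟩
    ((C ⋆ D) ⋆ X) m         ≈⟨ ⋆-congˡ C⋆D≈1 X m ⟩
    ((λ i → δ R i 0) ⋆ X) m ≈⟨ ⋆-identityˡ X m ⟩
    X m                     ∎

  ⋆-δʳ : ∀ F k n → (F ⋆ (λ i → δ R i k)) n ≈ cShift R F n k
  ⋆-δʳ F k n with k ≤? n
  ... | yes k≤n = begin
    (F ⋆ (λ i → δ R i k)) n         ≈⟨ ∑-single (suc n) (n ∸ k) (s≤s (ℕₚ.m∸n≤m n k)) off-diagonal ⟩
    F (n ∸ k) * δ R (n ∸ (n ∸ k)) k ≈⟨ *-congˡ (δ-≡ (ℕₚ.m∸[m∸n]≡n k≤n)) ⟩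
    F (n ∸ k) * 1#                  ≈⟨ *-identityʳ _ ⟩
    F (n ∸ k)                       ≈⟨ when-yes (k ≤? n) _ k≤n ⟨
    cShift R F n k                  ∎
    where
    off-diagonal : ∀ j → j < suc n → j ≢ n ∸ k → F j * δ R (n ∸ j) k ≈ 0#
    off-diagonal j (s≤s j≤n) j≢n∸k = trans (*-congˡ (δ-≢ {n ∸ j} λ n∸j≡k →
      j≢n∸k (≡.trans (≡.sym (ℕₚ.m∸[m∸n]≡n j≤n)) (≡.cong (n ∸_) n∸j≡k)))) (zeroʳ _)
  ... | no k≰n = trans (∑-zero (suc n) off-range) (sym (when-no (k ≤? n) _ k≰n))
    where
    off-range : ∀ j → j < suc n → F j * δ R (n ∸ j) k ≈ 0#
    off-range j _ = trans (*-congˡ (δ-≢ {n ∸ j} λ n∸j≡k →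
      k≰n (≡.subst (_≤ n) n∸j≡k (ℕₚ.m∸n≤m n j)))) (zeroʳ _)

  ∑-multiples : ∀ e t (F : ℕ → Carrier) → .{{NonZero e}} →
    ∑ (t ℕ.* e) (λ i → when (e ∣? suc i) (F (suc i))) ≈ ∑ t (λ u → F (e ℕ.* suc u))
  ∑-multiples e zero F = refl
  ∑-multiples e@(suc e′) (suc t) F = begin
    ∑ (suc t ℕ.* e) f
      ≡⟨ ≡.cong (λ n → ∑ n f) (ℕₚ.+-comm e (t ℕ.* e)) ⟩
    ∑ (t ℕ.* e ℕ.+ e) f
      ≈⟨ ∑-split (t ℕ.* e) e f ⟩
    ∑ (t ℕ.* e) f + ∑ e (λ i → f (t ℕ.* e ℕ.+ i))
      ≈⟨ +-cong (∑-multiples e t F) (∑-single e e′ ℕₚ.≤-refl non-multiple) ⟩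
    ∑ t (λ u → F (e ℕ.* suc u)) + f (t ℕ.* e ℕ.+ e′)
      ≈⟨ +-congˡ last-multiple ⟩
    ∑ t (λ u → F (e ℕ.* suc u)) + F (e ℕ.* suc t)
      ∎
    where
    f : ℕ → Carrier
    f i = when (e ∣? suc i) (F (suc i))
    non-multiple : ∀ i → i < e → i ≢ e′ → f (t ℕ.* e ℕ.+ i) ≈ 0#
    non-multiple i (s≤s i≤e′) i≢e′ = when-no (e ∣? _) _ λ e∣ →
      >⇒∤ (s≤s (ℕₚ.≤∧≢⇒< i≤e′ i≢e′))
          (∣m+n∣m⇒∣n (≡.subst (e ∣_) (≡.sym (ℕₚ.+-suc (t ℕ.* e) i)) e∣) (n∣m*n t))
    last-multiple : f (t ℕ.* e ℕ.+ e′) ≈ F (e ℕ.* suc t)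
    last-multiple = ≡.subst (λ x → when (e ∣? x) (F x) ≈ F (e ℕ.* suc t))
      (≡.sym (≡.trans (≡.sym (ℕₚ.+-suc (t ℕ.* e) e′))
                      (≡.trans (ℕₚ.+-comm (t ℕ.* e) e) (ℕₚ.*-comm (suc t) e))))
      (when-yes (e ∣? _) _ (m∣m*n (suc t)))

  ∑-cofactor : ∀ a m → .{{_ : NonZero a}} → .{{NonZero m}} → (G : ℕ → Carrier) →
    ∑ m (λ j → when (a ℕ.* suc j ≟ m) (G (suc j))) ≈ when (a ∣? m) (G (m / a))
  ∑-cofactor a m G with a ∣? m
  ... | no a∤m = ∑-zero m (λ j _ → when-no (_ ≟ m) _ λ a*j≡m →
                   a∤m (divides (suc j) (≡.trans (≡.sym a*j≡m) (ℕₚ.*-comm a (suc j)))))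
  ... | yes (divides zero m≡0) = contradiction m≡0 (ℕ.≢-nonZero⁻¹ m)
  ... | yes (divides (suc q) m≡q*a) =
    trans (∑-single m q q<m other-j)
          (trans (when-yes (_ ≟ m) _ (≡.trans (ℕₚ.*-comm a (suc q)) (≡.sym m≡q*a)))
                 (reflexive (≡.cong G (≡.sym (≡.trans (ℕ./-congˡ m≡q*a) (ℕ.m*n/n≡m (suc q) a))))))
    where
    q<m : q < m
    q<m = ≡.subst (q <_) (≡.sym m≡q*a) (ℕₚ.m≤m*n (suc q) a)
    other-j : ∀ j → j < m → j ≢ q → when (a ℕ.* suc j ≟ m) (G (suc j)) ≈ 0#
    other-j j _ j≢q = when-no (_ ≟ m) _ λ a*j≡m → j≢q (ℕₚ.suc-injective
      (ℕₚ.*-cancelʳ-≡ (suc j) (suc q) a (≡.trans (ℕₚ.*-comm (suc j) a) (≡.trans a*j≡m m≡q*a))))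

  divSum-cofactor : ∀ m (F : ℕ → Carrier) → divSumQ R m (λ _ q → F q) ≈ divSum R m F
  divSum-cofactor zero       F = refl
  divSum-cofactor m@(suc _) F = begin
    ∑ m (λ i → when (suc i ∣? m) (F (m / suc i)))
      ≈⟨ ∑-cong′ m (λ i → ∑-cofactor (suc i) m F) ⟨
    ∑ m (λ i → ∑ m (λ j → when (suc i ℕ.* suc j ≟ m) (F (suc j))))
      ≈⟨ ∑-swap m m _ ⟩
    ∑ m (λ j → ∑ m (λ i → when (suc i ℕ.* suc j ≟ m) (F (suc j))))
      ≈⟨ ∑-cong′ m (λ j → ∑-cong′ m (λ i →
           reflexive (≡.cong (λ x → when (x ≟ m) (F (suc j))) (ℕₚ.*-comm (suc i) (suc j))))) ⟩
    ∑ m (λ j → ∑ m (λ i → when (suc j ℕ.* suc i ≟ m) (F (suc j))))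
      ≈⟨ ∑-cong′ m (λ j → ∑-cofactor (suc j) m (λ _ → F (suc j))) ⟩
    ∑ m (λ j → when (suc j ∣? m) (F (suc j)))
      ∎

  divSum-μ-nontrivial : ∀ m → .{{ℕ.NonTrivial m}} → divSum R m μᴿ ≈ 0#
  divSum-μ-nontrivial m with ∃-prime-divisor m
  ... | p , pp , divides m′ ≡.refl = begin
    ∑ (m′ ℕ.* p) X                         ≈⟨ ∑-cong′ (m′ ℕ.* p) split ⟩
    ∑ (m′ ℕ.* p) (λ i → A i + B i)         ≈⟨ ∑-distrib-+ (m′ ℕ.* p) A B ⟩
    ∑ (m′ ℕ.* p) A + ∑ (m′ ℕ.* p) B        ≈⟨ +-cong (∑-extend A (ℕₚ.m≤m*n m′ p) A-beyond)
                                                     (∑-multiples p m′ Fd) ⟩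
    ∑ m′ A + ∑ m′ (λ u → Fd (p ℕ.* suc u)) ≈⟨ +-congˡ (trans (∑-cong′ m′ multiple-of-p) (∑-neg m′ A)) ⟩
    ∑ m′ A + - ∑ m′ A                      ≈⟨ -‿inverseʳ _ ⟩
    0#                                     ∎
    where
    instance
      _ = prime⇒nonZero pp
      _ = ℕₚ.m*n≢0⇒m≢0 m′ {{ℕ.nonTrivial⇒nonZero (m′ ℕ.* p)}}
    Fd : ℕ → Carrier
    Fd d = when (d ∣? m′ ℕ.* p) (μᴿ d)
    X A B : ℕ → Carrier
    X i = Fd (suc i)
    A i = when (¬? (p ∣? suc i)) (when (suc i ∣? m′) (μᴿ (suc i)))
    B i = when (p ∣? suc i) (X i)
    split : ∀ i → X i ≈ A i + B i
    split i with p ∣? suc i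
    ... | yes _  = sym (+-identityˡ _)
    ... | no p∤i = trans (when-⇔ (suc i ∣? m′ ℕ.* p) (suc i ∣? m′) _ (∣m*p⇒∣m pp p∤i) (∣m⇒∣m*n p))
                         (sym (+-identityʳ _))
    A-beyond : ∀ i → m′ ≤ i → i < m′ ℕ.* p → A i ≈ 0#
    A-beyond i m′≤i _ = trans (when-cong (¬? (p ∣? suc i)) (when-no (suc i ∣? m′) _ (>⇒∤ (s≤s m′≤i))))
                              (when-zero (¬? (p ∣? suc i)))
    μᴿ-≡ : ∀ d {z} → μ d ≡ z → μᴿ d ≈ intMul R z 1#
    μᴿ-≡ d μd≡z = reflexive (≡.cong (λ z → intMul R z 1#) μd≡z)
    multiple-of-p : ∀ u → Fd (p ℕ.* suc u) ≈ - A u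
    multiple-of-p u with p ∣? suc u
    ... | yes p∣u = begin
      when pu∣m? (μᴿ (p ℕ.* suc u)) ≈⟨ when-cong pu∣m? (μᴿ-≡ (p ℕ.* suc u) (μ-prime-*-∣ pp p∣u)) ⟩
      when pu∣m? 0#                 ≈⟨ when-zero pu∣m? ⟩
      0#                            ≈⟨ -0#≈0# ⟨
      - 0#                          ∎
      where pu∣m? = p ℕ.* suc u ∣? m′ ℕ.* p
    ... | no p∤u = begin
      when pu∣m? (μᴿ (p ℕ.* suc u))
        ≈⟨ when-cong pu∣m? (trans (μᴿ-≡ (p ℕ.* suc u) (μ-prime-* pp p∤u)) (intMul-neg (μ (suc u)))) ⟩
      when pu∣m? (- μᴿ (suc u))
        ≈⟨ when-⇔ pu∣m? (suc u ∣? m′) _ (m*n∣o*m⇒n∣o p) (n∣o⇒m*n∣o*m p) ⟩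
      when (suc u ∣? m′) (- μᴿ (suc u))
        ≈⟨ when-neg (suc u ∣? m′) _ ⟩
      - when (suc u ∣? m′) (μᴿ (suc u))
        ∎
      where pu∣m? = p ℕ.* suc u ∣? m′ ℕ.* p

  divSum-μ : ∀ m → .{{NonZero m}} → divSum R m μᴿ ≈ δ R m 1
  divSum-μ 1 = trans (+-identityˡ _) (trans (when-yes (1 ∣? 1) _ (1∣ 1)) (+-identityˡ _))
  divSum-μ m@(suc (suc _)) = trans (divSum-μ-nontrivial m) (sym (δ-≢ {m} {1} λ ()))

  ∑-divisors-extend : ∀ {d n} (h : ℕ → Carrier) → .{{NonZero d}} → d ≤ n →
    ∑ n (λ j → when (suc j ∣? d) (h (suc j))) ≈ divSum R d h
  ∑-divisors-extend {d} h d≤n = ∑-extend _ d≤n (λ j d≤j _ → when-no (suc j ∣? d) _ (>⇒∤ (s≤s d≤j)))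

  when²-no : ∀ {P Q : Set} (P? : Dec P) (Q? : Dec Q) x → (P → Q → ⊥) → when P? (when Q? x) ≈ 0#
  when²-no (yes p) (yes q) x ¬pq = contradiction q (¬pq p)
  when²-no (yes _) (no _)  x _   = refl
  when²-no (no _)  Q?      x _   = refl

  ∑-μ-between : ∀ e n → .{{NonZero e}} → e ≤ n →
    ∑ n (λ i → when (e ∣? suc i) (when (suc i ∣? n) (μᴿ (n / suc i)))) ≈ δ R e n
  ∑-μ-between e@(suc _) n e≤n with e ∣? n
  ... | no e∤n = trans (∑-zero n λ i _ → when²-no (e ∣? suc i) (suc i ∣? n) _ λ e∣i i∣n →
                                                 e∤n (∣-trans e∣i i∣n))
                       (sym (δ-≢ {e} {n} λ e≡n → e∤n (≡.subst (e ∣_) e≡n ∣-refl)))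
  ... | yes (divides t ≡.refl) = begin
    ∑ (t ℕ.* e) (λ i → when (e ∣? suc i) (Fd (suc i))) ≈⟨ ∑-multiples e t Fd ⟩
    ∑ t (λ u → Fd (e ℕ.* suc u))                        ≈⟨ ∑-cong′ t cancel-e ⟩
    divSumQ R t (λ _ q → μᴿ q)                           ≈⟨ divSum-cofactor t μᴿ ⟩
    divSum R t μᴿ                                        ≈⟨ divSum-μ t ⟩
    δ R t 1                                              ≈⟨ when-⇔ (t ≟ 1) (e ≟ t ℕ.* e) 1# t≡1⇒ ⇒t≡1 ⟩
    δ R e (t ℕ.* e)                                      ∎
    where
    instance _ = ℕₚ.m*n≢0⇒m≢0 t {{ℕ.>-nonZero (ℕₚ.<-≤-trans (ℕ.>-nonZero⁻¹ e) e≤n)}}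
    -- by cases, so that Fd (suc i) unfolds to the summand of divSumQ (dividing needs NonZero d)
    Fd : ℕ → Carrier
    Fd zero      = 0#
    Fd d@(suc _) = when (d ∣? t ℕ.* e) (μᴿ (t ℕ.* e / d))
    cancel-e : ∀ u → Fd (e ℕ.* suc u) ≈ when (suc u ∣? t) (μᴿ (t / suc u))
    cancel-e u = trans (when-cong (e ℕ.* suc u ∣? t ℕ.* e) (reflexive (≡.cong μᴿ te/eu≡t/u)))
                       (when-⇔ (e ℕ.* suc u ∣? t ℕ.* e) (suc u ∣? t) _ (m*n∣o*m⇒n∣o e) (n∣o⇒m*n∣o*m e))
      where
      te/eu≡t/u : t ℕ.* e / (e ℕ.* suc u) ≡ t / suc u
      te/eu≡t/u = ≡.trans (ℕ./-congˡ (ℕₚ.*-comm t e)) (ℕ.m*n/m*o≡n/o e t (suc u))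
    t≡1⇒ : t ≡ 1 → e ≡ t ℕ.* e
    t≡1⇒ ≡.refl = ≡.sym (ℕₚ.+-identityʳ e)
    ⇒t≡1 : e ≡ t ℕ.* e → t ≡ 1
    ⇒t≡1 e≡te = ℕₚ.*-cancelʳ-≡ t 1 e (≡.trans (≡.sym e≡te) (≡.sym (ℕₚ.*-identityˡ e)))

  möbius-inversion : ∀ (g h : ℕ → Carrier) → (∀ d → .{{NonZero d}} → g d ≈ divSum R d h) →
    ∀ n → .{{NonZero n}} → divSumQ R n (λ d q → intMul R (μ q) (g d)) ≈ h n
  möbius-inversion g h g≈∑h n@(suc n′) = begin
    ∑ n (λ i → when (suc i ∣? n) (intMul R (μ (n / suc i)) (g (suc i))))
      ≈⟨ ∑-cong′ n (λ i → expand i (suc i ∣? n)) ⟩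
    ∑ n (λ i → ∑ n (λ j → T i j))
      ≈⟨ ∑-swap n n T ⟩
    ∑ n (λ j → ∑ n (λ i → T i j))
      ≈⟨ ∑-cong n (λ j j<n → trans (sym (*-distribʳ-∑ n (h (suc j)) _))
                                    (*-congʳ (∑-μ-between (suc j) n j<n))) ⟩
    ∑ n (λ j → δ R (suc j) n * h (suc j))
      ≈⟨ ∑-single n n′ ℕₚ.≤-refl (λ j _ j≢n′ →
           trans (*-congʳ (δ-≢ (j≢n′ ∘ ℕₚ.suc-injective))) (zeroˡ _)) ⟩
    δ R n n * h n
      ≈⟨ trans (*-congʳ (δ-≡ {n} ≡.refl)) (*-identityˡ _) ⟩
    h n
      ∎
    where
    T : ℕ → ℕ → Carrier
    T i j = when (suc j ∣? suc i) (when (suc i ∣? n) (μᴿ (n / suc i))) * h (suc j)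
    expand : ∀ i (i∣n? : Dec (suc i ∣ n)) → when i∣n? (intMul R (μ (n / suc i)) (g (suc i)))
               ≈ ∑ n (λ j → when (suc j ∣? suc i) (when i∣n? (μᴿ (n / suc i))) * h (suc j))
    expand i (no _) = sym (∑-zero n (λ j _ → trans (*-congʳ (when-zero (suc j ∣? suc i))) (zeroˡ _)))
    expand i (yes i∣n) = begin
      intMul R (μ (n / suc i)) (g (suc i))
        ≈⟨ intMul≈* (μ (n / suc i)) (g (suc i)) ⟩
      μᴿ (n / suc i) * g (suc i)
        ≈⟨ *-congˡ (trans (g≈∑h (suc i)) (sym (∑-divisors-extend h (∣⇒≤ i∣n)))) ⟩
      μᴿ (n / suc i) * ∑ n (λ j → when (suc j ∣? suc i) (h (suc j)))
        ≈⟨ *-distribˡ-∑ n _ _ ⟩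
      ∑ n (λ j → μᴿ (n / suc i) * when (suc j ∣? suc i) (h (suc j)))
        ≈⟨ ∑-cong′ n (λ j → *-when (suc j ∣? suc i) _ _) ⟩
      ∑ n (λ j → when (suc j ∣? suc i) (μᴿ (n / suc i)) * h (suc j))
        ∎

  Σ₁-sTri : ∀ s {M N} (g : ℕ → Carrier) → M ≤ N →
    Σ₁ R N (λ j → sTri R s M j * g j) ≈ Σ₁ R M (λ j → s M j * g j)
  Σ₁-sTri s {M} {N} g M≤N = begin
    Σ₁ R N (λ j → sTri R s M j * g j)          ≡⟨ Σ₁≡∑ N _ ⟩
    ∑ N (λ i → sTri R s M (suc i) * g (suc i)) ≈⟨ ∑-extend _ M≤N above-diagonal ⟩
    ∑ M (λ i → sTri R s M (suc i) * g (suc i)) ≈⟨ ∑-cong M (λ i i<M → *-congʳ (when-yes (suc i ≤? M) _ i<M)) ⟩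
    ∑ M (λ i → s M (suc i) * g (suc i))        ≡⟨ Σ₁≡∑ M _ ⟨
    Σ₁ R M (λ j → s M j * g j)                 ∎
    where
    above-diagonal : ∀ i → M ≤ i → i < N → sTri R s M (suc i) * g (suc i) ≈ 0#
    above-diagonal i M≤i _ = trans (*-congʳ (when-no (suc i ≤? M) _ (ℕₚ.<⇒≱ (s≤s M≤i)))) (zeroˡ _)

  TriRightInverse : (s sinv : ℕ → ℕ → Carrier) → Set _
  TriRightInverse s sinv = ∀ N i k → 1 ≤ i → i ≤ N → 1 ≤ k → k ≤ N →
    Σ₁ R N (λ j → sTri R s i j * sinv j k) ≈ δ R i k

  sSeries-column : ∀ {s sinv} → TriRightInverse s sinv → ∀ {k} → 1 ≤ k → ∀ M →
    sSeries R s (λ d → sinv d k) M ≈ δ R M k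
  sSeries-column _ 1≤k zero = sym (δ-≢ (ℕₚ.<⇒≢ 1≤k))
  sSeries-column {s} s⋆sinv≈I {k} 1≤k M@(suc _) =
    trans (sym (Σ₁-sTri s _ (ℕₚ.m≤m⊔n M k)))
          (s⋆sinv≈I (M ℕ.⊔ k) M k (s≤s z≤n) (ℕₚ.m≤m⊔n M k) 1≤k (ℕₚ.m≤n⊔m M k))

  divSum-column : ∀ {cinv s sinv} →
    (∀ a m → lambertCoeff R a m ≈ (cinv ⋆ sSeries R s a) m) → TriRightInverse s sinv →
    ∀ {k} → 1 ≤ k → ∀ n → divSum R n (λ d → sinv d k) ≈ cShift R cinv n k
  divSum-column {cinv} {s} {sinv} lambert s⋆sinv≈I {k} 1≤k n = begin
    divSum R n (λ d → sinv d k)             ≈⟨ lambert (λ d → sinv d k) n ⟩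
    (cinv ⋆ sSeries R s (λ d → sinv d k)) n ≈⟨ ⋆-congʳ cinv (sSeries-column s⋆sinv≈I 1≤k) n ⟩
    (cinv ⋆ (λ i → δ R i k)) n              ≈⟨ ⋆-δʳ cinv k n ⟩
    cShift R cinv n k                       ∎

  BSeq-expansion : ∀ {C cinv} s → C 0 ≈ 1# → (∀ m → (C ⋆ cinv) m ≈ δ R m 0) →
    (∀ a m → lambertCoeff R a m ≈ (cinv ⋆ sSeries R s a) m) →
    ∀ a m → BSeq R s a m ≈ bSeq R a (suc m) + Σ₁ R m (λ k → C k * bSeq R a (suc m ∸ k))
  BSeq-expansion {C} {cinv} s C0≈1 C⋆cinv≈1 lambert a m = begin
    X (suc m)                                      ≈⟨ ⋆-inverseˡ C⋆cinv≈1 X (suc m) ⟨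
    (C ⋆ (cinv ⋆ X)) (suc m)                       ≈⟨ ⋆-congʳ C (λ i → sym (lambert a i)) (suc m) ⟩
    (C ⋆ L) (suc m)                                ≈⟨ ⋆-suc C L m ⟩
    C 0 * L (suc m) + (C ∘ suc ⋆ L) m              ≈⟨ +-cong (trans (*-congʳ C0≈1) (*-identityˡ _))
                                                             (trans (+-congˡ last≈0) (+-identityʳ _)) ⟩
    L (suc m) + ∑ m (λ j → C (suc j) * L (m ∸ j))  ≡⟨ ≡.cong (λ x → L (suc m) + x) (Σ₁≡∑ m _) ⟨
    L (suc m) + Σ₁ R m (λ k → C k * L (suc m ∸ k)) ∎
    where
    X L : ℕ → Carrier
    X = sSeries R s a
    L = lambertCoeff R a
    last≈0 : C (suc m) * L (m ∸ m) ≈ 0#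
    last≈0 = trans (*-congˡ (reflexive (≡.cong L (ℕₚ.n∸n≡0 m)))) (zeroʳ _)

theorem2 : ∀ {c ℓ} (R : CommutativeRing c ℓ) →
    let open CommutativeRing R in
    (C cinv : ℕ → Carrier) (s sinv : ℕ → ℕ → Carrier) →
    C 0 ≈ 1# →
    (∀ m → conv R C cinv m ≈ δ R m 0) →
    (∀ (a : ℕ → Carrier) (m : ℕ) → lambertCoeff R a m ≈ conv R cinv (sSeries R s a) m) →
    (∀ N i k → 1 ≤ i → i ≤ N → 1 ≤ k → k ≤ N →
      (Σ₁ R N (λ j → sTri R s i j * sinv j k) ≈ δ R i k)
      × (Σ₁ R N (λ j → sinv i j * sTri R s j k) ≈ δ R i k)) →
    (∀ n k → 1 ≤ k → k ≤ n →
      sinv n k ≈ divSumQ R n (λ d q → intMul R (μ q) (cShift R cinv d k)))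
    × (∀ n k → 1 ≤ k → k ≤ n → cinv (n ∸ k) ≈ divSum R n (λ d → sinv d k))
    × (∀ (a : ℕ → Carrier) (m : ℕ) →
      BSeq R s a m ≈ bSeq R a (suc m) + Σ₁ R m (λ k → C k * bSeq R a (suc m ∸ k)))
theorem2 R C cinv s sinv C0≈1 C⋆cinv≈1 lambert s-inverse = part-i , part-ii , part-iii
  where
  open CommutativeRing R
  column : ∀ {k} → 1 ≤ k → ∀ n → divSum R n (λ d → sinv d k) ≈ cShift R cinv n k
  column = divSum-column R lambert λ N i k 1≤i i≤N 1≤k k≤N → proj₁ (s-inverse N i k 1≤i i≤N 1≤k k≤N)
  part-i = λ n k 1≤k k≤n → sym (möbius-inversion R (λ d → cShift R cinv d k) (λ d → sinv d k)
                                  (λ d → sym (column 1≤k d)) n {{ℕ.>-nonZero (ℕₚ.≤-trans 1≤k k≤n)}})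
  part-ii = λ n k 1≤k k≤n → sym (trans (column 1≤k n) (when-yes R (k ≤? n) _ k≤n))
  part-iii = BSeq-expansion R s C0≈1 C⋆cinv≈1 lambert
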